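{- For every positive integer $n$ there exist $n$ points $p_1,\dots,p_n\in\mathbb{R}^n$ such that for every subset $I\subseteq\{1,\dots,n\}$ there exists a point $q_I\in\mathbb{R}^n$ with \[ \|p_i-q_I\|_\infty=\begin{cases}1/2 & \text{if } i\in I,\\ 3/2 & \text{if } i\notin I.\end{cases} \] Consequently, for $c<3$ and $|I|=k$, the only valid answer to the $(c,k)$-NN query $q_I$ on $\{p_1,\dots,p_n\}$ in $\ell_\infty$ is $\{p_i: i\in I\}$.
   Context: $(c,k)$-NN: for a point set $P$ and query $q$, a valid answer is a set of $k$ points of $P$ each at distance at most $c$ times the distance from $q$ to its $k$-th nearest neighbor in $P$.
   Formalization: The factor c is rational rather than real, and the points $p_1,\dots,p_n$ and the queries $q_I$ are taken in ℚ^n instead of $\mathbb{R}^n$. -}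

module Defs where

open import Data.Nat using (ℕ; zero; suc)
open import Data.Fin using (Fin)
open import Data.Fin.Subset using (Subset; _∈_; ∣_∣)
open import Data.List using (List; []; _∷_; map; foldr)
open import Data.List.Base using (allFin)
open import Data.Rational using (ℚ; 0ℚ; _-_; _*_; _≤_; _⊔_) renaming (∣_∣ to abs)
open import Data.Rational.Properties using (≤-decTotalOrder)
open import Data.Product using (_×_)
open import Relation.Binary.PropositionalEquality using (_≡_)
import Data.List.Sort

Point : ℕ → Set
Point n = Fin n → ℚ

dist∞ : ∀ {n} → Point n → Point n → ℚ
dist∞ {n} x y = foldr _⊔_ 0ℚ (map (λ j → abs (x j - y j)) (allFin n))

open Data.List.Sort ≤-decTotalOrder using (sort)

nth : List ℚ → ℕ → ℚ
nth []       _       = 0ℚ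
nth (x ∷ xs) zero    = x
nth (x ∷ xs) (suc k) = nth xs k

-- distance from q to its k-th nearest neighbour in P = {p i}, for k ≥ 1
-- (the k-th smallest of the multiset of distances); value for k = 0 is irrelevant
kthNNDist : ∀ {m n} → ℕ → (Fin m → Point n) → Point n → ℚ
kthNNDist {m} zero    p q = 0ℚ
kthNNDist {m} (suc k) p q = nth (sort (map (λ i → dist∞ (p i) q) (allFin m))) k

-- S (a set of indices into P, i.e. a set of points of P) is a valid (c,k)-NN answer for q
ValidAnswer : ∀ {m n} → ℚ → ℕ → (Fin m → Point n) → Point n → Subset m → Set
ValidAnswer c k p q S =
  (∣ S ∣ ≡ k) × (∀ i → i ∈ S → dist∞ (p i) q ≤ c * kthNNDist k p q)

module Submission where

-- Take the data points to be the unit vectors e₀ … eₙ of ℚ^(n+1) and, for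
-- I ⊆ {0 … n}, the query q_I with coordinate +½ on I and −½ off I.  Every
-- coordinate gap |eᵢ j − q_I j| is ½, except the diagonal one (j = i), which is
-- ½ when i ∈ I and 3/2 when i ∉ I; hence ‖eᵢ − q_I‖∞ is ½ or 3/2 accordingly.
-- So exactly ∣ I ∣ distances equal ½ and all others are larger, which makes the
-- ∣ I ∣-th nearest-neighbour distance K equal to ½ (K = 0 when I = ∅).  For
-- 1 ≤ c < 3 the points of I are within c·K, while c·K < 3/2 excludes every
-- other point; a valid answer is therefore a subset of I of size ∣ I ∣, i.e. I.

open import Defs
open import Data.Nat using (ℕ; suc)
open import Data.Integer using (+_)
open import Data.Fin using (Fin)
open import Data.Fin.Subset using (Subset; _∈_; _∉_; ∣_∣)
open import Data.Rational using (ℚ; _/_; _≤_; _<_; 1ℚ)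
open import Data.Product using (Σ; _×_)
open import Relation.Nullary using (Dec; yes; no)
open import Relation.Binary.PropositionalEquality using (_≡_)

open import Data.Nat as ℕ using (zero; s≤s; z≤n)
import Data.Nat.Properties as ℕP
import Data.Fin as Fin
open import Data.Fin.Subset using (_⊆_)
open import Data.Fin.Subset.Properties using (_∈?_; x∈p⇒∣p-x∣<∣p∣; drop-∷-⊆; p⊆q⇒∣p∣≤∣q∣)
open import Data.Vec using (lookup; []; _∷_; here)
open import Data.Vec.Properties using ([]=⇒lookup; lookup⇒[]=)
open import Data.Rational as ℚ using (0ℚ; -_; _*_; _⊔_; _-_; _≤?_) renaming (∣_∣ to abs)
import Data.Rational.Properties as ℚP
open import Data.Product using (_,_)
open import Data.Sum using (_⊎_; inj₁; inj₂)
open import Data.Bool using (Bool; true; false)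
open import Data.List using (List; []; _∷_; map; foldr; filter; length; tabulate; allFin)
open import Data.List.Properties
  using (filter-none; filter-accept; filter-reject; length-filter; map-tabulate; tabulate-cong;
         foldr-preservesᵇ; foldr-preservesᵒ)
import Data.List.Relation.Unary.Any as Any
open import Data.List.Relation.Unary.All as All using (All; _∷_)
import Data.List.Relation.Unary.All.Properties as AllP
open import Data.List.Membership.Propositional.Properties using (∈-map⁺; ∈-allFin)
import Data.List.Membership.Propositional as List
open import Data.List.Relation.Binary.Permutation.Propositional using (↭-sym)
open import Data.List.Relation.Binary.Permutation.Propositional.Properties
  using (All-resp-↭; filter-↭; ↭-length)
open import Data.List.Relation.Unary.Linked as Linked using (Linked)
open import Data.List.Relation.Unary.Linked.Properties using (Linked⇒All)
import Data.List.Sort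
open import Relation.Binary.PropositionalEquality using (refl; sym; trans; cong; subst; subst₂; _≢_)
open import Relation.Nullary using (¬_; contradiction)
open import Relation.Nullary.Decidable using (toWitness)
open import Data.Unit using (tt)
open Data.List.Sort ℚP.≤-decTotalOrder using (sort; sort-↭; sort-↗)

½ : ℚ
½ = + 1 / 2

³⁄₂ : ℚ
³⁄₂ = + 3 / 2

0≤½ : 0ℚ ≤ ½
0≤½ = toWitness {a? = 0ℚ ≤? ½} tt

½<³⁄₂ : ½ < ³⁄₂
½<³⁄₂ = toWitness {a? = ½ ℚ.<? ³⁄₂} tt

³⁄₂≰½ : ¬ ³⁄₂ ≤ ½
³⁄₂≰½ ³⁄₂≤½ = ℚP.<-irrefl refl (ℚP.<-≤-trans ½<³⁄₂ ³⁄₂≤½)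

foldr-⊔-attained : ∀ {M} {xs : List ℚ} → 0ℚ ≤ M → All (_≤ M) xs → M List.∈ xs →
                   foldr _⊔_ 0ℚ xs ≡ M
foldr-⊔-attained {M} {xs} 0≤M bounded M∈xs = ℚP.≤-antisym
  (foldr-preservesᵇ ℚP.⊔-lub 0≤M bounded)
  (foldr-preservesᵒ ≤-either 0ℚ xs (inj₂ (Any.map ℚP.≤-reflexive M∈xs)))
  where
  ≤-either : ∀ x y → M ≤ x ⊎ M ≤ y → M ≤ x ⊔ y
  ≤-either x y (inj₁ M≤x) = ℚP.≤-trans M≤x (ℚP.p≤p⊔q x y)
  ≤-either x y (inj₂ M≤y) = ℚP.≤-trans M≤y (ℚP.p≤q⊔p x y)

dist∞-attained : ∀ {n} (x y : Point n) {M} (j₀ : Fin n) →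
                 (∀ j → abs (x j - y j) ≤ M) → abs (x j₀ - y j₀) ≡ M → dist∞ x y ≡ M
dist∞-attained {n} x y j₀ bounded attained = foldr-⊔-attained
  (subst (0ℚ ≤_) attained (ℚP.0≤∣p∣ (x j₀ - y j₀)))
  (AllP.map⁺ (AllP.tabulate⁺ bounded))
  (subst (List._∈ map gap (allFin n)) attained (∈-map⁺ gap (∈-allFin j₀)))
  where
  gap : Fin n → ℚ
  gap j = abs (x j - y j)

#≤ : ℚ → List ℚ → ℕ
#≤ a xs = length (filter (_≤? a) xs)

sorted-beyond : ∀ {a x} {xs : List ℚ} → Linked _≤_ (x ∷ xs) → ¬ x ≤ a → All (λ y → ¬ y ≤ a) xs
sorted-beyond sorted x≰a =
  All.map (λ x≤y y≤a → x≰a (ℚP.≤-trans x≤y y≤a))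
          (All.tail (Linked⇒All ℚP.≤-trans ℚP.≤-refl sorted))

sorted-prefix-≤ : ∀ {a} (xs : List ℚ) k → Linked _≤_ xs → k ℕ.< #≤ a xs → nth xs k ≤ a
sorted-prefix-≤ {a} (x ∷ xs) k sorted k<# with x ≤? a
... | yes x≤a = head-or-tail k (subst (λ ys → k ℕ.< length ys) (filter-accept (_≤? a) x≤a) k<#)
  where
  head-or-tail : ∀ k → k ℕ.< suc (#≤ a xs) → nth (x ∷ xs) k ≤ a
  head-or-tail zero    _          = x≤a
  head-or-tail (suc k) (s≤s k<#) = sorted-prefix-≤ xs k (Linked.tail sorted) k<#
... | no x≰a  = contradiction
  (subst (λ ys → k ℕ.< length ys) (filter-none (_≤? a) (x≰a ∷ sorted-beyond sorted x≰a)) k<#)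
  ℕP.n≮0

nth-≥ : ∀ {a} (xs : List ℚ) k → All (a ≤_) xs → k ℕ.< length xs → a ≤ nth xs k
nth-≥ (x ∷ xs) zero    (a≤x ∷ _)    _         = a≤x
nth-≥ (x ∷ xs) (suc k) (_ ∷ a≤xs) (s≤s k<n) = nth-≥ xs k a≤xs k<n

sort-nth-threshold : ∀ {a} (xs : List ℚ) k → All (a ≤_) xs → k ℕ.< #≤ a xs → nth (sort xs) k ≡ a
sort-nth-threshold {a} xs k a≤xs k<# = ℚP.≤-antisym
  (sorted-prefix-≤ (sort xs) k (sort-↗ xs) k<#sorted)
  (nth-≥ (sort xs) k (All-resp-↭ (↭-sym (sort-↭ xs)) a≤xs)
         (ℕP.≤-trans k<#sorted (length-filter (_≤? a) (sort xs))))
  where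
  k<#sorted : k ℕ.< #≤ a (sort xs)
  k<#sorted = subst (k ℕ.<_) (↭-length (filter-↭ (_≤? a) (↭-sym (sort-↭ xs)))) k<#

∈⇒0<∣∣ : ∀ {m} {p : Subset m} {x} → x ∈ p → 0 ℕ.< ∣ p ∣
∈⇒0<∣∣ x∈p = ℕP.≤-<-trans z≤n (x∈p⇒∣p-x∣<∣p∣ x∈p)

⊆-∣∣-≡ : ∀ {m} {p q : Subset m} → p ⊆ q → ∣ p ∣ ≡ ∣ q ∣ → p ≡ q
⊆-∣∣-≡ {p = []}          {[]}          _   _  = refl
⊆-∣∣-≡ {p = true ∷ p}    {true ∷ q}    p⊆q eq =
  cong (true ∷_) (⊆-∣∣-≡ (drop-∷-⊆ p⊆q) (ℕP.suc-injective eq))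
⊆-∣∣-≡ {p = false ∷ p}   {false ∷ q}   p⊆q eq = cong (false ∷_) (⊆-∣∣-≡ (drop-∷-⊆ p⊆q) eq)
⊆-∣∣-≡ {p = true ∷ p}    {false ∷ q}   p⊆q _  with p⊆q here
... | ()
⊆-∣∣-≡ {p = false ∷ p}   {true ∷ q}    p⊆q eq =
  contradiction eq (ℕP.<⇒≢ (s≤s (p⊆q⇒∣p∣≤∣q∣ (drop-∷-⊆ p⊆q))))

unit : ∀ {m} → Fin m → Point m
unit i j with i Fin.≟ j
... | yes _ = 1ℚ
... | no _  = 0ℚ

query : ∀ {m} → Subset m → Point m
query I j = offset (lookup I j)
  where
  offset : Bool → ℚ
  offset true  = ½
  offset false = - ½

target : Bool → ℚ
target true  = ½
target false = ³⁄₂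

½≤target : ∀ b → ½ ≤ target b
½≤target true  = ℚP.≤-refl
½≤target false = ℚP.<⇒≤ ½<³⁄₂

gap-off-diagonal : ∀ {m} (I : Subset m) {i j} → i ≢ j → abs (unit i j - query I j) ≡ ½
gap-off-diagonal I {i} {j} i≢j with i Fin.≟ j
... | yes i≡j = contradiction i≡j i≢j
... | no _ with lookup I j
...   | true  = refl
...   | false = refl

gap-diagonal : ∀ {m} (I : Subset m) i → abs (unit i i - query I i) ≡ target (lookup I i)
gap-diagonal I i with i Fin.≟ i
... | no i≢i = contradiction refl i≢i
... | yes _ with lookup I i
...   | true  = refl
...   | false = refl

gap-≤-target : ∀ {m} (I : Subset m) i j → abs (unit i j - query I j) ≤ target (lookup I i)
gap-≤-target I i j = by-cases (i Fin.≟ j)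
  where
  by-cases : Dec (i ≡ j) → abs (unit i j - query I j) ≤ target (lookup I i)
  by-cases (yes refl) = ℚP.≤-reflexive (gap-diagonal I i)
  by-cases (no i≢j)   =
    subst (_≤ target (lookup I i)) (sym (gap-off-diagonal I i≢j)) (½≤target (lookup I i))

dist-unit-query : ∀ {m} (I : Subset m) i → dist∞ (unit i) (query I) ≡ target (lookup I i)
dist-unit-query I i = dist∞-attained (unit i) (query I) i (gap-≤-target I i) (gap-diagonal I i)

dist-∈ : ∀ {m} {I : Subset m} {i} → i ∈ I → dist∞ (unit i) (query I) ≡ ½
dist-∈ {I = I} {i} i∈I = trans (dist-unit-query I i) (cong target ([]=⇒lookup i∈I))

dist-∉ : ∀ {m} {I : Subset m} {i} → i ∉ I → dist∞ (unit i) (query I) ≡ ³⁄₂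
dist-∉ {I = I} {i} i∉I with lookup I i in eq
... | true  = contradiction (lookup⇒[]= i I eq) i∉I
... | false = trans (dist-unit-query I i) (cong target eq)

distances : ∀ {m} → Subset m → List ℚ
distances {m} I = map (λ i → dist∞ (unit i) (query I)) (allFin m)

targets : ∀ {m} → Subset m → List ℚ
targets I = tabulate (λ i → target (lookup I i))

distances-targets : ∀ {m} (I : Subset m) → distances I ≡ targets I
distances-targets I = trans (map-tabulate (λ i → i) _) (tabulate-cong (dist-unit-query I))

#≤-targets : ∀ {m} (I : Subset m) → #≤ ½ (targets I) ≡ ∣ I ∣
#≤-targets []          = refl
#≤-targets (true ∷ I)  =
  trans (cong length (filter-accept (_≤? ½) {xs = targets I} ℚP.≤-refl)) (cong suc (#≤-targets I))
#≤-targets (false ∷ I) =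
  trans (cong length (filter-reject (_≤? ½) {xs = targets I} ³⁄₂≰½)) (#≤-targets I)

kthNN-query : ∀ {m} (I : Subset m) k → ∣ I ∣ ≡ suc k → kthNNDist (suc k) unit (query I) ≡ ½
kthNN-query I k ∣I∣≡1+k = sort-nth-threshold (distances I) k ½≤distances k<#≤½
  where
  ½≤distances : All (½ ≤_) (distances I)
  ½≤distances = subst (All (½ ≤_)) (sym (distances-targets I))
                      (AllP.tabulate⁺ (λ i → ½≤target (lookup I i)))

  #≤½ : #≤ ½ (distances I) ≡ suc k
  #≤½ = trans (cong (#≤ ½) (distances-targets I)) (trans (#≤-targets I) ∣I∣≡1+k)

  k<#≤½ : k ℕ.< #≤ ½ (distances I)
  k<#≤½ = subst (k ℕ.<_) (sym #≤½) ℕP.≤-refl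

radius : ∀ {m} → ℚ → Subset m → ℚ
radius c I = c * kthNNDist ∣ I ∣ unit (query I)

members-within-radius : ∀ {m} (I : Subset m) c → 1ℚ ≤ c → ∀ {i} → i ∈ I →
                        dist∞ (unit i) (query I) ≤ radius c I
members-within-radius I c 1≤c {i} i∈I with ∣ I ∣ in ∣I∣≡
... | zero  = contradiction (subst (0 ℕ.<_) ∣I∣≡ (∈⇒0<∣∣ i∈I)) ℕP.n≮0
... | suc k = subst₂ _≤_ (sym (dist-∈ i∈I)) (cong (c *_) (sym (kthNN-query I k ∣I∣≡)))
                     (ℚP.*-monoʳ-≤-nonNeg ½ 1≤c)

radius-<-³⁄₂ : ∀ {m} (I : Subset m) c → c ℚ.< + 3 / 1 → radius c I ℚ.< ³⁄₂
radius-<-³⁄₂ I c c<3 with ∣ I ∣ in ∣I∣≡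
... | zero  = subst (ℚ._< ³⁄₂) (sym (ℚP.*-zeroʳ c)) (ℚP.≤-<-trans 0≤½ ½<³⁄₂)
... | suc k = subst (ℚ._< ³⁄₂) (cong (c *_) (sym (kthNN-query I k ∣I∣≡))) (ℚP.*-monoˡ-<-pos ½ c<3)

valid-answer-unique : ∀ {m} (I : Subset m) c → c ℚ.< + 3 / 1 →
                      (S : Subset m) → ValidAnswer c ∣ I ∣ unit (query I) S → S ≡ I
valid-answer-unique I c c<3 S (∣S∣≡∣I∣ , within) = ⊆-∣∣-≡ S⊆I ∣S∣≡∣I∣
  where
  S⊆I : S ⊆ I
  S⊆I {i} i∈S with i ∈? I
  ... | yes i∈I = i∈I
  ... | no i∉I  = contradiction
    (ℚP.≤-<-trans (subst (_≤ radius c I) (dist-∉ i∉I) (within i i∈S)) (radius-<-³⁄₂ I c c<3))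
    (ℚP.<-irrefl refl)

mainTheorem8 : (n : ℕ) → Σ (Fin (suc n) → Point (suc n)) λ p →
    (I : Subset (suc n)) → Σ (Point (suc n)) λ q →
      ((i : Fin (suc n)) → (i ∈ I → dist∞ (p i) q ≡ + 1 / 2) × ((i ∉ I) → dist∞ (p i) q ≡ + 3 / 2))
      × ((c : ℚ) → 1ℚ ≤ c → c < (+ 3 / 1) →
          ValidAnswer c ∣ I ∣ p q I × ((S : Subset (suc n)) → ValidAnswer c ∣ I ∣ p q S → S ≡ I))
mainTheorem8 n = unit , λ I → query I , (λ i → dist-∈ , dist-∉) , λ c 1≤c c<3 →
  (refl , λ i → members-within-radius I c 1≤c) , valid-answer-unique I c c<3
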